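{- Let $E_1,\dots,E_m$ be an ordering of edges defining a hypergraph tree $\mathcal{H}$, with a fixed parent function $\alpha$ (so $\alpha(i)<i$ and $E_i\cap\bigcup_{j<i}E_j\subseteq E_{\alpha(i)}$ for $i\geq 2$). Fix $i$ with $2\leq i\leq m$ and let $x\in E_i\setminus E_{\alpha(i)}$. Then $E_i$ is the first edge in the ordering that contains $x$. Moreover, if $y\in E_{\alpha(i)}\setminus E_i$, then no edge of $\mathcal{H}$ contains both $x$ and $y$.
   Context: A (multi-)hypergraph with edges $E_1,\dots,E_m$ is a hypergraph tree if for every $i>1$ there is $\alpha(i)<i$ with $E_i\cap\bigcup_{j<i}E_j\subseteq E_{\alpha(i)}$; such an ordering is tree-defining and $E_{\alpha(i)}$ is the parent of $E_i$. -}

module Defs where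

open import Level using (Level; _⊔_; suc)
open import Data.Nat using (ℕ)
open import Data.Fin using (Fin; toℕ; _<_)
open import Data.Product using (Σ; ∃; _×_)
open import Relation.Nullary using (¬_)

-- A (multi-)hypergraph on vertex type V with m edges, listed in order
-- E 0, …, E (m-1) (0-based indexing; paper's E_1 is our E 0).
-- Edges are subsets of V given as predicates.
Edges : ∀ {a} → Set a → ℕ → Set (suc a)
Edges {a} V m = Fin m → V → Set a

IsTreeParent : ∀ {a} {V : Set a} {m : ℕ} → Edges V m → (Fin m → Fin m) → Set a
IsTreeParent {V = V} {m} E α =
  (i : Fin m) → 0 Data.Nat.< toℕ i →
    (α i < i) ×
    ((x : V) → E i x → (∃ λ j → (j < i) × E j x) → E (α i) x)

FirstContaining : ∀ {a} {V : Set a} {m : ℕ} → Edges V m → V → Fin m → Set a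
FirstContaining {m = m} E x i = E i x × ((j : Fin m) → j < i → ¬ E j x)

module Submission where

-- In a tree-defining ordering a vertex x of E i that is not in
-- the parent E (α i) cannot occur in any earlier edge: otherwise the tree
-- condition would put x into E (α i).  For the second claim we prove a
-- general separation principle: if x ∈ E i, y lies in some edge before i,
-- and no edge up to E i contains both x and y, then no edge at all does.
-- An edge E k with k > i containing both would, by the tree condition
-- (both vertices already appear before k), pass both to its parent
-- E (α k) with α k < k, so well-founded descent along α ends at an edge
-- up to E i containing both — impossible.  The theorem follows by taking
-- the witness α i for y: edges before E i miss x, and E i misses y.

open import Defs
open import Data.Nat using (ℕ; s≤s; z≤n)
open import Data.Fin using (Fin; toℕ; _<_; _≤_)
open import Data.Fin.Properties using (<-cmp; <-trans; ≤-refl)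
open import Data.Fin.Induction using (<-wellFounded)
open import Data.Nat.Properties using (≤-trans; <⇒≤; <⇒≱)
open import Data.Product using (_×_; _,_; proj₁; proj₂)
open import Induction.WellFounded using (Acc; acc)
open import Relation.Nullary using (¬_)
open import Relation.Binary.Definitions using (tri<; tri≈; tri>)
open import Relation.Binary.PropositionalEquality using (refl)

module _ {a} {V : Set a} {m : ℕ} (E : Edges V m) (α : Fin m → Fin m)
         (tree : IsTreeParent E α) where

  notInEarlierEdges : (i : Fin m) → 0 Data.Nat.< toℕ i →
    (x : V) → E i x → ¬ E (α i) x → (j : Fin m) → j < i → ¬ E j x
  notInEarlierEdges i pos x Eix ¬Eαix j j<i Ejx =
    ¬Eαix (proj₂ (tree i pos) x Eix (j , j<i , Ejx))

  separated : (i : Fin m) (x y : V) → E i x →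
    (j : Fin m) → j < i → E j y →
    ((k : Fin m) → k ≤ i → ¬ (E k x × E k y)) →
    (k : Fin m) → ¬ (E k x × E k y)
  separated i x y Eix j j<i Ejy upToI k = descend k (<-wellFounded k)
    where
    descend : (k : Fin m) → Acc _<_ k → ¬ (E k x × E k y)
    descend k (acc rec) (Ekx , Eky) with <-cmp k i
    ... | tri< k<i _ _ = upToI k (<⇒≤ k<i) (Ekx , Eky)
    ... | tri≈ _ refl _ = upToI k ≤-refl (Ekx , Eky)
    ... | tri> _ _ i<k =
      descend (α k) (rec αk<k) (inherit x Ekx i i<k Eix , inherit y Eky j (<-trans j<i i<k) Ejy)
      where
      kPos : 0 Data.Nat.< toℕ k
      kPos = ≤-trans (s≤s z≤n) i<k

      αk<k : α k < k
      αk<k = proj₁ (tree k kPos)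

      inherit : (z : V) → E k z → (l : Fin m) → l < k → E l z → E (α k) z
      inherit z Ekz l l<k Elz = proj₂ (tree k kPos) z Ekz (l , l<k , Elz)

lemma5p5 : ∀ {a} {V : Set a} {m : ℕ} (E : Edges V m) (α : Fin m → Fin m) →
    IsTreeParent E α →
    (i : Fin m) → 0 Data.Nat.< toℕ i →
    (x : V) → E i x → ¬ E (α i) x →
    FirstContaining E x i ×
    ((y : V) → E (α i) y → ¬ E i y → (k : Fin m) → ¬ (E k x × E k y))
lemma5p5 {V = V} {m = m} E α tree i pos x Eix ¬Eαix = (Eix , earlierMissX) , noCommonEdge
  where
  earlierMissX : (j : Fin m) → j < i → ¬ E j x
  earlierMissX = notInEarlierEdges E α tree i pos x Eix ¬Eαix

  noCommonEdge : (y : V) → E (α i) y → ¬ E i y → (k : Fin m) → ¬ (E k x × E k y)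
  noCommonEdge y Eαiy ¬Eiy =
    separated E α tree i x y Eix (α i) (proj₁ (tree i pos)) Eαiy upToI
    where
    upToI : (k : Fin m) → k ≤ i → ¬ (E k x × E k y)
    upToI k k≤i (Ekx , Eky) with <-cmp k i
    ... | tri< k<i _ _ = earlierMissX k k<i Ekx
    ... | tri≈ _ refl _ = ¬Eiy Eky
    ... | tri> _ _ i<k = <⇒≱ i<k k≤i
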